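{- Let $G$ be the reduced bipartite graph with colour classes $X=\{x_1,\dots,x_k\}$ and $Y=\{y_1,\dots,y_{d_k}\}$, where $d_1\le\cdots\le d_k$ are positive integers and $x_i$ is adjacent exactly to $y_1,\dots,y_{d_i}$. Suppose $G$ admits an edge decomposition $$G=F_1\oplus F_2\oplus\cdots\oplus F_n$$ into star forests with centres in $X$ (i.e. every vertex of $Y$ has degree at most one in each $F_j$), where $F_i$ has exactly $i$ edges. Then $$\sum_{i=0}^{t-1}d_{k-i}\ge\sum_{i=0}^{t-1}(n-i)\qquad\text{for each } t=1,\dots,k.$$
   Context: A star forest is a forest each of whose components is a star. $\oplus$ denotes edge-disjoint union, so the $F_j$ partition the edge set of $G$. The decomposition is not required to be ascending. -}

module Defs where

open import Data.Nat using (ℕ; zero; suc; _<_; _≤_; _∸_; _<?_)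
open import Data.Fin using (Fin; toℕ; fromℕ<)
open import Data.Integer using (ℤ; +_; _-_) renaming (_+_ to _+ℤ_)
open import Relation.Binary.PropositionalEquality using (_≡_)
open import Relation.Nullary using (yes; no)
open import Relation.Nullary.Decidable using (⌊_⌋)
open import Data.Fin using (_≟_)
open import Data.Bool using (if_then_else_)

sumℕ : ℕ → (ℕ → ℕ) → ℕ
sumℕ zero f = 0
sumℕ (suc t) f = sumℕ t f Data.Nat.+ f t

sumℤ : ℕ → (ℕ → ℤ) → ℤ
sumℤ zero f = + 0
sumℤ (suc t) f = sumℤ t f +ℤ f t

sumFin : (m : ℕ) → (Fin m → ℕ) → ℕ
sumFin zero f = 0
sumFin (suc m) f = f Fin.zero Data.Nat.+ sumFin m (λ i → f (Fin.suc i))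

-- The reduced bipartite graph on X = Fin k, with x_i adjacent to y_0 … y_{d i - 1}.
-- An edge at x_i is given by j : Fin (d i), representing the edge x_i y_{toℕ j}.
-- An edge colouring with n colours (colour m ∈ Fin n corresponds to F_{m+1}).
Colouring : (k : ℕ) → (Fin k → ℕ) → ℕ → Set
Colouring k d n = (i : Fin k) → Fin (d i) → Fin n

colourCount : (k : ℕ) (d : Fin k → ℕ) (n : ℕ) → Colouring k d n → Fin n → ℕ
colourCount k d n c m =
  sumFin k (λ i → sumFin (d i) (λ j → if ⌊ c i j ≟ m ⌋ then 1 else 0))

-- Each colour class is a star forest with centres in X:
-- every y has at most one incident edge of each colour.
StarForestsCentredInX : (k : ℕ) (d : Fin k → ℕ) (n : ℕ) → Colouring k d n → Set
StarForestsCentredInX k d n c =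
  (i i' : Fin k) (j : Fin (d i)) (j' : Fin (d i')) →
  toℕ j ≡ toℕ j' → c i j ≡ c i' j' → i ≡ i'

-- d extended to ℕ (0-indexed): dAt m = d_{m+1} for m < k, 0 otherwise
dAt : (k : ℕ) → (Fin k → ℕ) → ℕ → ℕ
dAt k d m with m <? k
... | yes m<k = d (fromℕ< m<k)
... | no _ = 0

module Submission where

-- For i < n call the colour class with n - i edges (the forest
-- F_{n-i}) the class of rank i.  For t ≤ k the left-hand side Σ_{i<t} (n - i)
-- counts the edges of the t largest classes; count them at their endpoints
-- y_l in Y.  Since every class is a star forest centred in X, y_l meets at most
-- one edge of each class, and since each edge has exactly one colour, y_l meets
-- at most deg(y_l) of them; so y_l carries at most
--   min(t, deg y_l) = Σ_{s<t} [s < deg y_l]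
-- of these edges.  By monotonicity of d, deg(y_l) > s forces y_l to be adjacent
-- to x_{k-s}, i.e. l < d_{k-s}, and summing Σ_l [l < d_{k-s}] = d_{k-s} over
-- the vertices y_l gives the right-hand side.

open import Defs
open import Data.Nat using (ℕ; zero; suc; _+_; _≤_; _<_; _∸_; _⊓_; z≤n; z<s; _<?_; _≤?_)
  renaming (_≟_ to _≟ℕ_)
open import Data.Nat.Properties
open import Data.Fin using (Fin; toℕ; fromℕ<) renaming (_≟_ to _≟ᶠ_)
open import Data.Fin.Properties using (toℕ-injective; toℕ<n; fromℕ<-toℕ; toℕ-fromℕ<)
open import Data.Integer using (ℤ; +_; _-_; +≤+) renaming (_≤_ to _≤ℤ_; _+_ to _+ℤ_)
import Data.Integer.Properties as ℤP
open import Algebra.Properties.CommutativeSemigroup +-commutativeSemigroup using (interchange)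
open import Data.Bool using (if_then_else_)
open import Data.Product using (Σ; _×_; _,_)
open import Data.Empty using (⊥-elim)
open import Relation.Binary.PropositionalEquality
  using (_≡_; refl; sym; trans; cong; cong₂; subst; subst₂; module ≡-Reasoning)
open import Relation.Nullary using (Dec; yes; no; ¬_)
open import Relation.Nullary.Decidable using (⌊_⌋)

-- The indicator of a decided proposition, written exactly as in colourCount.
𝟙 : {P : Set} → Dec P → ℕ
𝟙 D = if ⌊ D ⌋ then 1 else 0

𝟙≤1 : {P : Set} (D : Dec P) → 𝟙 D ≤ 1
𝟙≤1 (yes _) = ≤-refl
𝟙≤1 (no _)  = z≤n

𝟙-sound : {P : Set} (D : Dec P) → 0 < 𝟙 D → P
𝟙-sound (yes p) _ = p

𝟙-no : {P : Set} (D : Dec P) → ¬ P → 𝟙 D ≡ 0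
𝟙-no (yes p) ¬p = ⊥-elim (¬p p)
𝟙-no (no _)  _  = refl

𝟙-mono : {P Q : Set} (D : Dec P) (E : Dec Q) → (P → Q) → 𝟙 D ≤ 𝟙 E
𝟙-mono (yes _) (yes _)  _ = ≤-refl
𝟙-mono (yes p) (no ¬q)  f = ⊥-elim (¬q (f p))
𝟙-mono (no _)  _        _ = z≤n

𝟙-cong : {P Q : Set} (D : Dec P) (E : Dec Q) → (P → Q) → (Q → P) → 𝟙 D ≡ 𝟙 E
𝟙-cong D E f g = ≤-antisym (𝟙-mono D E f) (𝟙-mono E D g)

sumℕ-cong : ∀ m {f g : ℕ → ℕ} → (∀ i → i < m → f i ≡ g i) → sumℕ m f ≡ sumℕ m g
sumℕ-cong zero    h = refl
sumℕ-cong (suc m) h = cong₂ _+_ (sumℕ-cong m (λ i i<m → h i (m<n⇒m<1+n i<m))) (h m ≤-refl)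

sumℕ-mono : ∀ m {f g : ℕ → ℕ} → (∀ i → i < m → f i ≤ g i) → sumℕ m f ≤ sumℕ m g
sumℕ-mono zero    h = z≤n
sumℕ-mono (suc m) h = +-mono-≤ (sumℕ-mono m (λ i i<m → h i (m<n⇒m<1+n i<m))) (h m ≤-refl)

sumℕ-zero : ∀ m {f : ℕ → ℕ} → (∀ i → i < m → f i ≡ 0) → sumℕ m f ≡ 0
sumℕ-zero zero    h = refl
sumℕ-zero (suc m) h = cong₂ _+_ (sumℕ-zero m (λ i i<m → h i (m<n⇒m<1+n i<m))) (h m ≤-refl)

sumℕ-one : ∀ m → sumℕ m (λ _ → 1) ≡ m
sumℕ-one zero    = refl
sumℕ-one (suc m) = trans (cong (_+ 1) (sumℕ-one m)) (+-comm m 1)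

sumℕ-+ : ∀ m (f g : ℕ → ℕ) → sumℕ m (λ i → f i + g i) ≡ sumℕ m f + sumℕ m g
sumℕ-+ zero    f g = refl
sumℕ-+ (suc m) f g =
  trans (cong (_+ (f m + g m)) (sumℕ-+ m f g)) (interchange (sumℕ m f) (sumℕ m g) (f m) (g m))

sumℕ-interchange : ∀ a b (f : ℕ → ℕ → ℕ) →
  sumℕ a (λ i → sumℕ b (f i)) ≡ sumℕ b (λ j → sumℕ a (λ i → f i j))
sumℕ-interchange zero    b f = sym (sumℕ-zero b (λ _ _ → refl))
sumℕ-interchange (suc a) b f =
  trans (cong (_+ sumℕ b (f a)) (sumℕ-interchange a b f))
        (sym (sumℕ-+ b (λ j → sumℕ a (λ i → f i j)) (f a)))

sumℕ-reverse₃ : ∀ a b e (f : ℕ → ℕ → ℕ → ℕ) →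
  sumℕ a (λ i → sumℕ b (λ x → sumℕ e (f i x))) ≡ sumℕ e (λ l → sumℕ b (λ x → sumℕ a (λ i → f i x l)))
sumℕ-reverse₃ a b e f = begin
  sumℕ a (λ i → sumℕ b (λ x → sumℕ e (f i x)))          ≡⟨ sumℕ-interchange a b _ ⟩
  sumℕ b (λ x → sumℕ a (λ i → sumℕ e (f i x)))          ≡⟨ sumℕ-cong b (λ x _ → sumℕ-interchange a e _) ⟩
  sumℕ b (λ x → sumℕ e (λ l → sumℕ a (λ i → f i x l)))  ≡⟨ sumℕ-interchange b e _ ⟩
  sumℕ e (λ l → sumℕ b (λ x → sumℕ a (λ i → f i x l)))  ∎
  where open ≡-Reasoning

sumℕ-tail : ∀ m D (f : ℕ → ℕ) → m ≤ D → (∀ j → m ≤ j → f j ≡ 0) → sumℕ D f ≡ sumℕ m f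
sumℕ-tail m zero    f z≤n h = refl
sumℕ-tail m (suc D) f m≤1+D h with m ≤? D
... | yes m≤D = trans (cong₂ _+_ (sumℕ-tail m D f m≤D h) (h D m≤D)) (+-identityʳ _)
... | no  m≰D = cong (λ e → sumℕ e f) (sym (≤-antisym m≤1+D (≰⇒> m≰D)))

atMostOneNonzero : ∀ m {f : ℕ → ℕ} b → (∀ i → i < m → f i ≤ b) →
  (∀ i j → 0 < f i → 0 < f j → i ≡ j) → sumℕ m f ≤ b
atMostOneNonzero zero    b bound unique = z≤n
atMostOneNonzero (suc m) {f} b bound unique with 0 <? f m
... | no f[m]≯0 = begin
    sumℕ m f + f m  ≡⟨ cong (_+_ (sumℕ m f)) (n≤0⇒n≡0 (≮⇒≥ f[m]≯0)) ⟩
    sumℕ m f + 0    ≡⟨ +-identityʳ _ ⟩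
    sumℕ m f        ≤⟨ atMostOneNonzero m b (λ i i<m → bound i (m<n⇒m<1+n i<m)) unique ⟩
    b               ∎
  where open ≤-Reasoning
... | yes f[m]>0 = begin
    sumℕ m f + f m  ≡⟨ cong (_+ f m) (sumℕ-zero m earlierVanish) ⟩
    f m             ≤⟨ bound m ≤-refl ⟩
    b               ∎
  where
  open ≤-Reasoning
  earlierVanish : ∀ i → i < m → f i ≡ 0
  earlierVanish i i<m = n≤0⇒n≡0 (≮⇒≥ (λ f[i]>0 → <-irrefl (unique i m f[i]>0 f[m]>0) i<m))

countFrom : ∀ k m {f : ℕ → ℕ} → (∀ i → f i ≤ 1) → (∀ i → i < m → f i ≡ 0) → sumℕ k f ≤ k ∸ m
countFrom zero    m f≤1 vanish = z≤n
countFrom (suc k) m {f} f≤1 vanish with k <? m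
... | yes k<m = begin
    sumℕ k f + f k  ≡⟨ trans (cong (_+_ (sumℕ k f)) (vanish k k<m)) (+-identityʳ _) ⟩
    sumℕ k f        ≤⟨ countFrom k m f≤1 vanish ⟩
    k ∸ m           ≤⟨ ∸-monoˡ-≤ m (n≤1+n k) ⟩
    suc k ∸ m       ∎
  where open ≤-Reasoning
... | no k≮m = begin
    sumℕ k f + f k  ≤⟨ +-mono-≤ (countFrom k m f≤1 vanish) (f≤1 k) ⟩
    k ∸ m + 1       ≡⟨ +-comm (k ∸ m) 1 ⟩
    1 + (k ∸ m)     ≡⟨ sym (+-∸-assoc 1 (≮⇒≥ k≮m)) ⟩
    suc k ∸ m       ∎
  where open ≤-Reasoning

sumℕ-below : ∀ t x → sumℕ t (λ s → 𝟙 (s <? x)) ≡ t ⊓ x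
sumℕ-below zero    x = refl
sumℕ-below (suc t) x with t <? x
... | yes t<x = begin
    sumℕ t (λ s → 𝟙 (s <? x)) + 1  ≡⟨ cong (_+ 1) (trans (sumℕ-below t x) (m≤n⇒m⊓n≡m (<⇒≤ t<x))) ⟩
    t + 1                           ≡⟨ +-comm t 1 ⟩
    suc t                           ≡⟨ sym (m≤n⇒m⊓n≡m t<x) ⟩
    suc t ⊓ x                       ∎
  where open ≡-Reasoning
... | no t≮x = begin
    sumℕ t (λ s → 𝟙 (s <? x)) + 0  ≡⟨ +-identityʳ _ ⟩
    sumℕ t (λ s → 𝟙 (s <? x))      ≡⟨ trans (sumℕ-below t x) (m≥n⇒m⊓n≡n (≮⇒≥ t≮x)) ⟩
    x                               ≡⟨ sym (m≥n⇒m⊓n≡n (m≤n⇒m≤1+n (≮⇒≥ t≮x))) ⟩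
    suc t ⊓ x                       ∎
  where open ≡-Reasoning

extend : (m : ℕ) → (Fin m → ℕ) → ℕ → ℕ
extend m f j with j <? m
... | yes j<m = f (fromℕ< j<m)
... | no  _   = 0

extend-in : ∀ m (f : Fin m → ℕ) j (j<m : j < m) → extend m f j ≡ f (fromℕ< j<m)
extend-in m f j j<m with j <? m
... | yes _   = refl
... | no j≮m  = ⊥-elim (j≮m j<m)

extend-toℕ : ∀ m (f : Fin m → ℕ) (x : Fin m) → extend m f (toℕ x) ≡ f x
extend-toℕ m f x = trans (extend-in m f (toℕ x) (toℕ<n x)) (cong f (fromℕ<-toℕ x (toℕ<n x)))

extend-out : ∀ m (f : Fin m → ℕ) j → m ≤ j → extend m f j ≡ 0
extend-out m f j m≤j with j <? m
... | yes j<m = ⊥-elim (<⇒≱ j<m m≤j)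
... | no  _   = refl

extend-bound : ∀ m {f : Fin m → ℕ} {b} → (∀ x → f x ≤ b) → ∀ j → extend m f j ≤ b
extend-bound m {f} f≤b j with j <? m
... | yes j<m = f≤b (fromℕ< j<m)
... | no  _   = z≤n

extend-support : ∀ m (f : Fin m → ℕ) j → 0 < extend m f j → Σ (Fin m) λ x → toℕ x ≡ j × 0 < f x
extend-support m f j pos with j <? m
... | yes j<m = fromℕ< j<m , toℕ-fromℕ< j<m , pos

extend-sum : ∀ m D (g : Fin m → ℕ → ℕ) j →
  extend m (λ x → sumℕ D (g x)) j ≡ sumℕ D (λ l → extend m (λ x → g x l) j)
extend-sum m D g j with j <? m
... | yes _ = refl
... | no  _ = sym (sumℕ-zero D (λ _ _ → refl))

sumFin-cong : ∀ m {f g : Fin m → ℕ} → (∀ x → f x ≡ g x) → sumFin m f ≡ sumFin m g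
sumFin-cong zero    h = refl
sumFin-cong (suc m) h = cong₂ _+_ (h Fin.zero) (sumFin-cong m (λ x → h (Fin.suc x)))

sumFin-extend : ∀ m (f : Fin m → ℕ) → sumFin m f ≡ sumℕ m (extend m f)
sumFin-extend m f = trans (sumFin-cong m (λ x → sym (extend-toℕ m f x))) (sumFin-toℕ m (extend m f))
  where
  sumℕ-front : ∀ m (g : ℕ → ℕ) → sumℕ (suc m) g ≡ g 0 + sumℕ m (λ i → g (suc i))
  sumℕ-front zero    g = +-comm 0 (g 0)
  sumℕ-front (suc m) g = trans (cong (_+ g (suc m)) (sumℕ-front m g)) (+-assoc (g 0) _ _)
  sumFin-toℕ : ∀ m (g : ℕ → ℕ) → sumFin m (λ x → g (toℕ x)) ≡ sumℕ m g
  sumFin-toℕ zero    g = refl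
  sumFin-toℕ (suc m) g =
    trans (cong (_+_ (g 0)) (sumFin-toℕ m (λ i → g (suc i)))) (sym (sumℕ-front m g))

term≤sumFin : ∀ m (f : Fin m → ℕ) (x : Fin m) → f x ≤ sumFin m f
term≤sumFin (suc m) f Fin.zero    = m≤m+n _ _
term≤sumFin (suc m) f (Fin.suc x) = ≤-trans (term≤sumFin m (λ y → f (Fin.suc y)) x) (m≤n+m _ _)

extend≤sumFin : ∀ m (f : Fin m → ℕ) j → extend m f j ≤ sumFin m f
extend≤sumFin m f j with j <? m
... | yes j<m = term≤sumFin m f (fromℕ< j<m)
... | no  _   = z≤n

dAt≡extend : ∀ k (d : Fin k → ℕ) x → dAt k d x ≡ extend k d x
dAt≡extend k d x with x <? k
... | yes _ = refl
... | no  _ = refl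

module DoubleCount (k : ℕ) (d : Fin k → ℕ)
  (mono : ∀ i j → toℕ i ≤ toℕ j → d i ≤ d j)
  (n : ℕ) (c : Colouring k d n)
  (starForests : StarForestsCentredInX k d n c) where

  -- Colour a is of rank i when its class is F_{n-i}, the (i+1)-st largest.
  Rank : ℕ → Fin n → Set
  Rank i a = suc (toℕ a) + i ≡ n

  rank? : ∀ i a → Dec (Rank i a)
  rank? i a = suc (toℕ a) + i ≟ℕ n

  rank-colour-unique : ∀ {i a b} → Rank i a → Rank i b → a ≡ b
  rank-colour-unique {i} ra rb = toℕ-injective (suc-injective (+-cancelʳ-≡ i _ _ (trans ra (sym rb))))

  rank-index-unique : ∀ {i j a} → Rank i a → Rank j a → i ≡ j
  rank-index-unique {a = a} ri rj = +-cancelˡ-≡ (suc (toℕ a)) _ _ (trans ri (sym rj))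

  rank-exists : ∀ {i} → i < n → Σ (Fin n) (Rank i)
  rank-exists {i} i<n = fromℕ< n∸[1+i]<n , (begin
      suc (toℕ (fromℕ< n∸[1+i]<n)) + i  ≡⟨ cong (λ e → suc e + i) (toℕ-fromℕ< n∸[1+i]<n) ⟩
      suc (n ∸ suc i) + i               ≡⟨ cong (_+ i) (sym (+-∸-assoc 1 i<n)) ⟩
      n ∸ i + i                         ≡⟨ m∸n+n≡m (<⇒≤ i<n) ⟩
      n                                 ∎)
    where
    open ≡-Reasoning
    n∸[1+i]<n : n ∸ suc i < n
    n∸[1+i]<n = ∸-monoʳ-< z<s i<n

  rank-size : ∀ {i a} → Rank i a → n ∸ i ≡ suc (toℕ a)
  rank-size {i} {a} r = trans (cong (_∸ i) (sym r)) (m+n∸n≡m (suc (toℕ a)) i)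

  -- E i x l = 1 iff the x-th vertex of X and y_l span an edge of rank i
  -- (indices in ℕ, extended by zero off the graph).
  E : ℕ → ℕ → ℕ → ℕ
  E i x l = extend k (λ x → extend (d x) (λ j → 𝟙 (rank? i (c x j))) l) x

  A : ℕ → ℕ → ℕ
  A x l = 𝟙 (l <? dAt k d x)

  deg : ℕ → ℕ
  deg l = sumℕ k (λ x → A x l)

  E-support : ∀ {i x l} → 0 < E i x l →
    Σ (Fin k) λ x' → Σ (Fin (d x')) λ j → toℕ x' ≡ x × toℕ j ≡ l × Rank i (c x' j)
  E-support {i} {x} {l} pos with extend-support k _ x pos
  ... | x' , x'≡x , pos' with extend-support (d x') _ l pos'
  ...   | j , j≡l , pos'' = x' , j , x'≡x , j≡l , 𝟙-sound (rank? i (c x' j)) pos''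

  E≤1 : ∀ i x l → E i x l ≤ 1
  E≤1 i x l = extend-bound k (λ x' → extend-bound (d x') (λ j → 𝟙≤1 (rank? i (c x' j))) l) x

  E≤A : ∀ i x l → E i x l ≤ A x l
  E≤A i x l with l <? dAt k d x
  ... | yes _   = E≤1 i x l
  ... | no  l≮d = ≮⇒≥ (λ pos → l≮d (edge-in-row pos))
    where
    edge-in-row : 0 < E i x l → l < dAt k d x
    edge-in-row pos with E-support pos
    ... | x' , j , refl , refl , _ =
      subst (toℕ j <_) (sym (trans (dAt≡extend k d (toℕ x')) (extend-toℕ k d x'))) (toℕ<n j)

  same-edge : ∀ x x' (j : Fin (d x)) (j' : Fin (d x')) → toℕ x ≡ toℕ x' → toℕ j ≡ toℕ j' → c x j ≡ c x' j'
  same-edge x x' j j' x≡x' j≡j' with toℕ-injective x≡x'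
  ... | refl = cong (c x) (toℕ-injective j≡j')

  -- An edge has only one colour, so at most one rank.
  one-rank : ∀ {i i' x l} → 0 < E i x l → 0 < E i' x l → i ≡ i'
  one-rank p p' with E-support p | E-support p'
  ... | x , j , ex , ej , r | x' , j' , ex' , ej' , r' =
    rank-index-unique r (subst (Rank _) (sym (same-edge x x' j j' (trans ex (sym ex')) (trans ej (sym ej')))) r')

  -- A star forest centred in X meets y_l at most once.
  one-centre : ∀ {i x x' l} → 0 < E i x l → 0 < E i x' l → x ≡ x'
  one-centre p p' with E-support p | E-support p'
  ... | y , j , refl , ej , r | y' , j' , refl , ej' , r' =
    cong toℕ (starForests y y' j j' (trans ej (sym ej')) (rank-colour-unique r r'))

  load-at-centre : ∀ t x l → sumℕ t (λ i → E i x l) ≤ A x l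
  load-at-centre t x l = atMostOneNonzero t (A x l) (λ i _ → E≤A i x l) (λ _ _ → one-rank)

  load-of-rank : ∀ i l → sumℕ k (λ x → E i x l) ≤ 1
  load-of-rank i l = atMostOneNonzero k 1 (λ x _ → E≤1 i x l) (λ _ _ → one-centre)

  load : ∀ t l → sumℕ k (λ x → sumℕ t (λ i → E i x l)) ≤ t ⊓ deg l
  load t l = ⊓-glb atMost-t (sumℕ-mono k (λ x _ → load-at-centre t x l))
    where
    open ≤-Reasoning
    atMost-t : sumℕ k (λ x → sumℕ t (λ i → E i x l)) ≤ t
    atMost-t = begin
      sumℕ k (λ x → sumℕ t (λ i → E i x l))  ≡⟨ sumℕ-interchange k t (λ x i → E i x l) ⟩
      sumℕ t (λ i → sumℕ k (λ x → E i x l))  ≤⟨ sumℕ-mono t (λ i _ → load-of-rank i l) ⟩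
      sumℕ t (λ _ → 1)                        ≡⟨ sumℕ-one t ⟩
      t                                       ∎

  dAt-mono : ∀ {x y} → x ≤ y → y < k → dAt k d x ≤ dAt k d y
  dAt-mono {x} {y} x≤y y<k = begin
    dAt k d x          ≡⟨ trans (dAt≡extend k d x) (extend-in k d x x<k) ⟩
    d (fromℕ< x<k)     ≤⟨ mono _ _ (subst₂ _≤_ (sym (toℕ-fromℕ< x<k)) (sym (toℕ-fromℕ< y<k)) x≤y) ⟩
    d (fromℕ< y<k)     ≡⟨ sym (trans (dAt≡extend k d y) (extend-in k d y y<k)) ⟩
    dAt k d y          ∎
    where
    open ≤-Reasoning
    x<k : x < k
    x<k = ≤-<-trans x≤y y<k

  -- If more than s vertices of X are adjacent to y_l, then so is x_{k-s}
  -- (0-indexed: k ∸ 1 ∸ s), since the neighbourhoods are nested.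
  deg-bound : ∀ {s l} → s < k → s < deg l → l < dAt k d (k ∸ 1 ∸ s)
  deg-bound {s} {l} s<k s<deg with l <? dAt k d (k ∸ 1 ∸ s)
  ... | yes l<d = l<d
  ... | no  l≮d = ⊥-elim (<⇒≱ s<deg deg≤s)
    where
    k∸1∸s≡k∸[1+s] : k ∸ 1 ∸ s ≡ k ∸ suc s
    k∸1∸s≡k∸[1+s] = ∸-+-assoc k 1 s
    top<k : k ∸ 1 ∸ s < k
    top<k = subst (_< k) (sym k∸1∸s≡k∸[1+s]) (∸-monoʳ-< z<s s<k)
    belowTop : ∀ x → x < k ∸ s → x ≤ k ∸ 1 ∸ s
    belowTop x x<k∸s =
      subst (x ≤_) (trans (pred[m∸n]≡m∸[1+n] k s) (sym k∸1∸s≡k∸[1+s])) (suc[m]≤n⇒m≤pred[n] x<k∸s)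
    nonAdjacent : ∀ x → x < k ∸ s → A x l ≡ 0
    nonAdjacent x x<k∸s =
      𝟙-no (l <? dAt k d x) (λ l<d → l≮d (<-≤-trans l<d (dAt-mono (belowTop x x<k∸s) top<k)))
    deg≤s : deg l ≤ s
    deg≤s = subst (deg l ≤_) (m∸[m∸n]≡n (<⇒≤ s<k))
      (countFrom k (k ∸ s) (λ x → 𝟙≤1 (l <? dAt k d x)) nonAdjacent)

  degree-profile : ∀ {t} l → t ≤ k → t ⊓ deg l ≤ sumℕ t (λ s → 𝟙 (l <? dAt k d (k ∸ 1 ∸ s)))
  degree-profile {t} l t≤k = begin
    t ⊓ deg l                                       ≡⟨ sym (sumℕ-below t (deg l)) ⟩
    sumℕ t (λ s → 𝟙 (s <? deg l))                  ≤⟨ sumℕ-mono t (λ s s<t →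
                                                         𝟙-mono _ _ (deg-bound (<-≤-trans s<t t≤k))) ⟩
    sumℕ t (λ s → 𝟙 (l <? dAt k d (k ∸ 1 ∸ s)))    ∎
    where open ≤-Reasoning

  -- Every vertex y_l with an edge has l < D.
  D : ℕ
  D = sumFin k d

  class-size : ∀ {i a} → Rank i a → colourCount k d n c a ≡ sumℕ k (λ x → sumℕ D (E i x))
  class-size {i} {a} r = begin
    colourCount k d n c a
      ≡⟨ sumFin-cong k (λ x → sumFin-cong (d x) (λ j → 𝟙-cong (c x j ≟ᶠ a) (rank? i (c x j))
           (λ c≡a → subst (Rank i) (sym c≡a) r) (λ r' → rank-colour-unique r' r))) ⟩
    sumFin k (λ x → sumFin (d x) (λ j → 𝟙 (rank? i (c x j))))
      ≡⟨ sumFin-cong k (λ x → sumFin-extend (d x) _) ⟩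
    sumFin k (λ x → sumℕ (d x) (row x))
      ≡⟨ sumFin-cong k (λ x → sym (sumℕ-tail (d x) D (row x) (term≤sumFin k d x) (extend-out (d x) _))) ⟩
    sumFin k (λ x → sumℕ D (row x))
      ≡⟨ sumFin-extend k _ ⟩
    sumℕ k (extend k (λ x → sumℕ D (row x)))
      ≡⟨ sumℕ-cong k (λ x _ → extend-sum k D row x) ⟩
    sumℕ k (λ x → sumℕ D (E i x))
      ∎
    where
    open ≡-Reasoning
    row : Fin k → ℕ → ℕ
    row x = extend (d x) (λ j → 𝟙 (rank? i (c x j)))

  rank-class-size : (∀ m → colourCount k d n c m ≡ suc (toℕ m)) →
    ∀ i → n ∸ i ≤ sumℕ k (λ x → sumℕ D (E i x))
  rank-class-size sizes i with i <? n
  ... | no  i≮n = subst (_≤ sumℕ k (λ x → sumℕ D (E i x))) (sym (m≤n⇒m∸n≡0 (≮⇒≥ i≮n))) z≤n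
  ... | yes i<n with rank-exists i<n
  ...   | a , r = ≤-reflexive (trans (rank-size r) (trans (sym (sizes a)) (class-size r)))

  largest-forests : (∀ m → colourCount k d n c m ≡ suc (toℕ m)) →
    ∀ t → t ≤ k → sumℕ t (λ i → n ∸ i) ≤ sumℕ t (λ s → dAt k d (k ∸ 1 ∸ s))
  largest-forests sizes t t≤k = begin
    sumℕ t (λ i → n ∸ i)
      ≤⟨ sumℕ-mono t (λ i _ → rank-class-size sizes i) ⟩
    sumℕ t (λ i → sumℕ k (λ x → sumℕ D (E i x)))
      ≡⟨ sumℕ-reverse₃ t k D E ⟩
    sumℕ D (λ l → sumℕ k (λ x → sumℕ t (λ i → E i x l)))
      ≤⟨ sumℕ-mono D (λ l _ → ≤-trans (load t l) (degree-profile l t≤k)) ⟩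
    sumℕ D (λ l → sumℕ t (λ s → 𝟙 (l <? dAt k d (k ∸ 1 ∸ s))))
      ≡⟨ sumℕ-interchange D t _ ⟩
    sumℕ t (λ s → sumℕ D (λ l → 𝟙 (l <? dAt k d (k ∸ 1 ∸ s))))
      ≡⟨ sumℕ-cong t (λ s _ → column-size (k ∸ 1 ∸ s)) ⟩
    sumℕ t (λ s → dAt k d (k ∸ 1 ∸ s))
      ∎
    where
    open ≤-Reasoning
    column-size : ∀ x → sumℕ D (λ l → 𝟙 (l <? dAt k d x)) ≡ dAt k d x
    column-size x = trans (sumℕ-below D (dAt k d x))
      (m≥n⇒m⊓n≡n (subst (_≤ D) (sym (dAt≡extend k d x)) (extend≤sumFin k d x)))

sumℤ-fromℕ : ∀ t (f : ℕ → ℕ) → sumℤ t (λ i → + f i) ≡ + sumℕ t f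
sumℤ-fromℕ zero    f = refl
sumℤ-fromℕ (suc t) f = cong (_+ℤ + f t) (sumℤ-fromℕ t f)

sumℤ-mono : ∀ t {f g : ℕ → ℤ} → (∀ i → f i ≤ℤ g i) → sumℤ t f ≤ℤ sumℤ t g
sumℤ-mono zero    h = ℤP.≤-refl
sumℤ-mono (suc t) h = ℤP.+-mono-≤ (sumℤ-mono t h) (h t)

minus≤monus : ∀ n i → + n - + i ≤ℤ + (n ∸ i)
minus≤monus n i with i ≤? n
... | yes i≤n = ℤP.≤-reflexive (trans (ℤP.m-n≡m⊖n n i) (ℤP.⊖-≥ i≤n))
... | no  i≰n = subst (_≤ℤ + (n ∸ i)) (sym (trans (ℤP.m-n≡m⊖n n i) (ℤP.⊖-< (≰⇒> i≰n)))) ℤP.neg-≤-pos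

lemma5 : (k : ℕ) (d : Fin k → ℕ) →
    (∀ i → 1 ≤ d i) →
    (∀ i j → toℕ i ≤ toℕ j → d i ≤ d j) →
    (n : ℕ) (c : Colouring k d n) →
    StarForestsCentredInX k d n c →
    (∀ m → colourCount k d n c m ≡ suc (toℕ m)) →
    ∀ t → 1 ≤ t → t ≤ k →
    sumℤ t (λ i → + n - + i) ≤ℤ sumℤ t (λ i → + dAt k d (k ∸ 1 ∸ i))
lemma5 k d _ mono n c starForests sizes t _ t≤k = begin
  sumℤ t (λ i → + n - + i)                 ≤⟨ sumℤ-mono t (minus≤monus n) ⟩
  sumℤ t (λ i → + (n ∸ i))                 ≡⟨ sumℤ-fromℕ t _ ⟩
  + sumℕ t (λ i → n ∸ i)                   ≤⟨ +≤+ (DoubleCount.largest-forests k d mono n c starForests sizes t t≤k) ⟩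
  + sumℕ t (λ i → dAt k d (k ∸ 1 ∸ i))     ≡⟨ sym (sumℤ-fromℕ t _) ⟩
  sumℤ t (λ i → + dAt k d (k ∸ 1 ∸ i))     ∎
  where open ℤP.≤-Reasoning
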